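{- Let $n \ge 0$ and let $x \in D_{n+2}$, decomposed as $x = (x_0, x_1, x_2, x_3)$ with $x_0, x_1, x_2, x_3 \in D_n$. Then $$\#[x, \top] = \sum_{y_0 \in [x_0, \top]} \; \sum_{y_3 \in [x_3, \top]} \#[\,y_0 \cup x_1,\ y_3\,] \cdot \#[\,y_0 \cup x_2,\ y_3\,],$$ where the intervals on the right-hand side are taken in $D_n$. Equivalently, writing $M_{D_n}$ for the incidence matrix of $D_n$, the summand equals $(M_{D_n})^2(y_0 \cup x_1, y_3)\cdot (M_{D_n})^2(y_0 \cup x_2, y_3)$.
   Context: $B=\{0,1\}$ with $0 \le 1$, and $B^n$ carries the componentwise order. $D_n$ is the set of monotone Boolean functions $f: B^n \to B$ (i.e. $x \le y \Rightarrow f(x) \le f(y)$), partially ordered pointwise: $f \le g$ iff $f(x) \le g(x)$ for all $x \in B^n$. For $f,g \in D_n$, $f \cup g$ denotes the pointwise maximum (bitwise OR) and $f \cap g$ the pointwise minimum (bitwise AND). For $f, g \in D_n$, the interval $[f,g]$ is the set of $h \in D_n$ with $f \le h \le g$, and $\#[f,g]$ is its cardinality (equal to $0$ if $f \not\le g$); $[f, \top]$ denotes the set of $g \in D_n$ with $f \le g$ and $\#[f,\top]$ its cardinality. The incidence matrix $M_{D_n}$ has rows and columns indexed by $D_n$, with entry $1$ at $(f,g)$ if $f \le g$ and $0$ otherwise; $(M_{D_n})^2$ is its matrix square. Decomposition: a function $x \in D_{n+2}$ is identified with the tuple $(x_0,x_1,x_2,x_3)$ of functions in $D_n$ given by $x_{2a+b}(z)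 = x(a,b,z)$ for $a,b \in B$, $z \in B^n$; this identifies $D_{n+2}$ with the monotone maps $B^2 \to D_n$, i.e. tuples with $x_0 \le x_1 \le x_3$ and $x_0 \le x_2 \le x_3$, ordered componentwise. -}

module Defs where

open import Data.Nat using (ℕ; zero; suc; _+_; _*_)
open import Data.Bool using (Bool; true; false; _∧_; _∨_; not; if_then_else_)
open import Data.List using (List; []; _∷_; map; concatMap; filterᵇ; length)
open import Data.Vec using (Vec; []; _∷_)

all : ∀ {A : Set} → (A → Bool) → List A → Bool
all p [] = true
all p (a ∷ as) = p a ∧ all p as

_≤ᵇ_ : Bool → Bool → Bool
false ≤ᵇ _ = true
true  ≤ᵇ b = b

leqV : ∀ {n} → Vec Bool n → Vec Bool n → Bool
leqV [] [] = true
leqV (a ∷ u) (b ∷ v) = (a ≤ᵇ b) ∧ leqV u v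

allVecs : (n : ℕ) → List (Vec Bool n)
allVecs zero = [] ∷ []
allVecs (suc n) = map (false ∷_) (allVecs n) Data.List.++ map (true ∷_) (allVecs n)

Fun : ℕ → Set
Fun n = Vec Bool n → Bool

-- Enumeration of all Boolean functions B^n → B, each (up to extensional
-- equality) exactly once: a function on B^(n+1) is a pair of functions on B^n.
allFuns : (n : ℕ) → List (Fun n)
allFuns zero = (λ _ → false) ∷ (λ _ → true) ∷ []
allFuns (suc n) =
  concatMap (λ f → map (λ g → pair f g) (allFuns n)) (allFuns n)
  where
  pair : Fun n → Fun n → Fun (suc n)
  pair f g (false ∷ z) = f z
  pair f g (true  ∷ z) = g z

leqF : ∀ {n} → Fun n → Fun n → Bool
leqF {n} f g = all (λ z → f z ≤ᵇ g z) (allVecs n)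

isMono : ∀ {n} → Fun n → Bool
isMono {n} f = all (λ u → all (λ v → not (leqV u v) ∨ (f u ≤ᵇ f v)) (allVecs n)) (allVecs n)

D : (n : ℕ) → List (Fun n)
D n = filterᵇ isMono (allFuns n)

_∪_ : ∀ {n} → Fun n → Fun n → Fun n
(f ∪ g) z = f z ∨ g z

_∩_ : ∀ {n} → Fun n → Fun n → Fun n
(f ∩ g) z = f z ∧ g z

interval : ∀ {n} → Fun n → Fun n → List (Fun n)
interval {n} f g = filterᵇ (λ h → leqF f h ∧ leqF h g) (D n)

#[_,_] : ∀ {n} → Fun n → Fun n → ℕ
#[ f , g ] = length (interval f g)

up : ∀ {n} → Fun n → List (Fun n)
up {n} f = filterᵇ (λ g → leqF f g) (D n)

#[_,⊤] : ∀ {n} → Fun n → ℕ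
#[ f ,⊤] = length (up f)

-- Decomposition of x ∈ D_{n+2}: x_{2a+b}(z) = x(a,b,z).
comp0 comp1 comp2 comp3 : ∀ {n} → Fun (suc (suc n)) → Fun n
comp0 x z = x (false ∷ false ∷ z)
comp1 x z = x (false ∷ true  ∷ z)
comp2 x z = x (true  ∷ false ∷ z)
comp3 x z = x (true  ∷ true  ∷ z)

-- Split h ∈ D_{n+2} into its four cofactors (a, b, c, d) in D_n. Then h is monotone
-- with x ≤ h iff a, b, c, d are monotone, a ≤ b ≤ d, a ≤ c ≤ d and x_i ≤ the i-th cofactor;
-- a ≤ b and x₁ ≤ b together say a ∪ x₁ ≤ b. So once the corners a ∈ [x₀,⊤] and
-- d ∈ [x₃,⊤] are fixed, b and c range independently over [a ∪ x₁, d] and [a ∪ x₂, d].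
-- Both sides are computed as sums of 0/1 indicators over all quadruples (a, b, c, d).
module Submission where

open import Defs
open import Data.Nat using (ℕ; suc; _+_; _*_)
open import Data.Nat.Properties using (+-assoc; +-identityʳ; *-assoc; *-zeroʳ; *-distribˡ-+; *-distribʳ-+)
open import Data.Nat.ListAction using (sum)
open import Data.Nat.Tactic.RingSolver using (solve-∀)
open import Data.Bool using (Bool; true; false; T; _∧_; _∨_; not)
open import Data.Bool.Properties using (T-∧)
open import Data.List using (List; []; _∷_; map; _++_; concatMap; filterᵇ; length)
open import Data.List.Membership.Propositional using (_∈_)
open import Data.List.Membership.Propositional.Properties using (∈-++⁺ˡ; ∈-++⁺ʳ; ∈-map⁺)
open import Data.List.Relation.Unary.Any using (here; there)
open import Data.Vec using (Vec; []; _∷_)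
open import Data.Product using (_,_; proj₁; proj₂)
open import Data.Unit using (tt)
open import Data.Empty using (⊥-elim)
open import Function using (Equivalence)
open import Relation.Binary.PropositionalEquality using (_≡_; refl; sym; trans; cong; cong₂; module ≡-Reasoning)

open Equivalence using (to; from)

private variable A B : Set

∑ : List A → (A → ℕ) → ℕ
∑ xs f = sum (map f xs)

∑-syntax : List A → (A → ℕ) → ℕ
∑-syntax = ∑

infix 5 ∑-syntax
syntax ∑-syntax xs (λ x → e) = ∑[ x ∈ xs ] e

∑-cong : ∀ (xs : List A) {f g : A → ℕ} → (∀ a → f a ≡ g a) → ∑ xs f ≡ ∑ xs g
∑-cong []       eq = refl
∑-cong (a ∷ xs) eq = cong₂ _+_ (eq a) (∑-cong xs eq)

∑-++ : ∀ (f : A → ℕ) xs ys → ∑ (xs ++ ys) f ≡ ∑ xs f + ∑ ys f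
∑-++ f []       ys = refl
∑-++ f (a ∷ xs) ys = trans (cong (f a +_) (∑-++ f xs ys)) (sym (+-assoc (f a) _ _))

∑-zero : ∀ (xs : List A) → ∑[ _ ∈ xs ] 0 ≡ 0
∑-zero []       = refl
∑-zero (_ ∷ xs) = ∑-zero xs

∑-+ : ∀ (f g : A → ℕ) xs → ∑[ a ∈ xs ] (f a + g a) ≡ ∑ xs f + ∑ xs g
∑-+ f g []       = refl
∑-+ f g (a ∷ xs) = trans (cong (f a + g a +_) (∑-+ f g xs)) (interchange (f a) (g a) _ _)
  where
  interchange : ∀ p q r s → p + q + (r + s) ≡ p + r + (q + s)
  interchange = solve-∀

*-distribˡ-∑ : ∀ c (f : A → ℕ) xs → c * ∑ xs f ≡ ∑[ a ∈ xs ] c * f a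
*-distribˡ-∑ c f []       = *-zeroʳ c
*-distribˡ-∑ c f (a ∷ xs) = trans (*-distribˡ-+ c (f a) _) (cong (c * f a +_) (*-distribˡ-∑ c f xs))

*-distribʳ-∑ : ∀ c (f : A → ℕ) xs → ∑ xs f * c ≡ ∑[ a ∈ xs ] f a * c
*-distribʳ-∑ c f []       = refl
*-distribʳ-∑ c f (a ∷ xs) = trans (*-distribʳ-+ c (f a) _) (cong (f a * c +_) (*-distribʳ-∑ c f xs))

∑-*-∑ : ∀ (f : A → ℕ) (g : B → ℕ) xs ys →
        ∑ xs f * ∑ ys g ≡ ∑[ a ∈ xs ] ∑[ b ∈ ys ] f a * g b
∑-*-∑ f g xs ys = trans (*-distribʳ-∑ _ f xs) (∑-cong xs λ a → *-distribˡ-∑ (f a) g ys)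

∑-comm : ∀ (f : A → B → ℕ) xs (ys : List B) →
         ∑[ a ∈ xs ] ∑[ b ∈ ys ] f a b ≡ ∑[ b ∈ ys ] ∑[ a ∈ xs ] f a b
∑-comm f []       ys = sym (∑-zero ys)
∑-comm f (a ∷ xs) ys = trans (cong (∑ ys (f a) +_) (∑-comm f xs ys))
                             (sym (∑-+ (f a) (λ b → ∑[ a′ ∈ xs ] f a′ b) ys))

∑-concatMap-map : ∀ (f : B → ℕ) (g : A → A → B) xs ys →
                  ∑ (concatMap (λ a → map (g a) ys) xs) f ≡ ∑[ a ∈ xs ] ∑[ b ∈ ys ] f (g a b)
∑-concatMap-map f g []       ys = refl
∑-concatMap-map f g (a ∷ xs) ys =
  trans (∑-++ f (map (g a) ys) _) (cong₂ _+_ (∑-map ys) (∑-concatMap-map f g xs ys))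
  where
  ∑-map : ∀ zs → ∑ (map (g a) zs) f ≡ ∑[ b ∈ zs ] f (g a b)
  ∑-map []       = refl
  ∑-map (b ∷ zs) = cong (f (g a b) +_) (∑-map zs)

ind : Bool → ℕ
ind true  = 1
ind false = 0

ind-∧ : ∀ p q → ind (p ∧ q) ≡ ind p * ind q
ind-∧ true  q = sym (+-identityʳ (ind q))
ind-∧ false q = refl

module _ (p : A → Bool) where

  length-filterᵇ : ∀ xs → length (filterᵇ p xs) ≡ ∑[ a ∈ xs ] ind (p a)
  length-filterᵇ []       = refl
  length-filterᵇ (a ∷ xs) with p a
  ... | true  = cong suc (length-filterᵇ xs)
  ... | false = length-filterᵇ xs

  ∑-filterᵇ : ∀ (f : A → ℕ) xs → ∑ (filterᵇ p xs) f ≡ ∑[ a ∈ xs ] ind (p a) * f a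
  ∑-filterᵇ f []       = refl
  ∑-filterᵇ f (a ∷ xs) with p a
  ... | true  = cong₂ _+_ (sym (+-identityʳ (f a))) (∑-filterᵇ f xs)
  ... | false = ∑-filterᵇ f xs

T-ext : ∀ {a b} → (T a → T b) → (T b → T a) → a ≡ b
T-ext {true}  {true}  _ _ = refl
T-ext {true}  {false} f _ = ⊥-elim (f tt)
T-ext {false} {true}  _ g = ⊥-elim (g tt)
T-ext {false} {false} _ _ = refl

module _ (p : A → Bool) where

  T-all⁻ : ∀ xs → T (all p xs) → ∀ {z} → z ∈ xs → T (p z)
  T-all⁻ (a ∷ xs) t (here refl) = proj₁ (to T-∧ t)
  T-all⁻ (a ∷ xs) t (there z∈)  = T-all⁻ xs (proj₂ (to T-∧ t)) z∈

  T-all⁺ : ∀ xs → (∀ z → T (p z)) → T (all p xs)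
  T-all⁺ []       _ = tt
  T-all⁺ (a ∷ xs) h = from T-∧ (h a , T-all⁺ xs h)

∈-allVecs : ∀ n (z : Vec Bool n) → z ∈ allVecs n
∈-allVecs 0       []          = here refl
∈-allVecs (suc n) (false ∷ z) = ∈-++⁺ˡ (∈-map⁺ (false ∷_) (∈-allVecs n z))
∈-allVecs (suc n) (true ∷ z)  = ∈-++⁺ʳ (map (false ∷_) (allVecs n)) (∈-map⁺ (true ∷_) (∈-allVecs n z))

T-allVecs⁻ : ∀ {n} (p : Vec Bool n → Bool) → T (all p (allVecs n)) → ∀ z → T (p z)
T-allVecs⁻ {n} p t z = T-all⁻ p (allVecs n) t (∈-allVecs n z)

T-allVecs⁺ : ∀ {n} (p : Vec Bool n → Bool) → (∀ z → T (p z)) → T (all p (allVecs n))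
T-allVecs⁺ {n} p = T-all⁺ p (allVecs n)

≤ᵇ-trans : ∀ {a b c} → T (a ≤ᵇ b) → T (b ≤ᵇ c) → T (a ≤ᵇ c)
≤ᵇ-trans {false}       _ _   = tt
≤ᵇ-trans {true} {true} _ b≤c = b≤c

leqV-refl : ∀ {n} (u : Vec Bool n) → T (leqV u u)
leqV-refl []          = tt
leqV-refl (false ∷ u) = leqV-refl u
leqV-refl (true ∷ u)  = leqV-refl u

_≤F_ : ∀ {n} → Fun n → Fun n → Set
f ≤F g = ∀ z → T (f z ≤ᵇ g z)

Monotone : ∀ {n} → Fun n → Set
Monotone f = ∀ u v → T (leqV u v) → T (f u ≤ᵇ f v)

leqF⁻ : ∀ {n} (f g : Fun n) → T (leqF f g) → f ≤F g
leqF⁻ f g = T-allVecs⁻ (λ z → f z ≤ᵇ g z)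

leqF⁺ : ∀ {n} (f g : Fun n) → f ≤F g → T (leqF f g)
leqF⁺ f g = T-allVecs⁺ (λ z → f z ≤ᵇ g z)

isMono⁻ : ∀ {n} (f : Fun n) → T (isMono f) → Monotone f
isMono⁻ f t u v u≤v = implies (T-allVecs⁻ _ (T-allVecs⁻ _ t u) v) u≤v
  where
  implies : ∀ {p q} → T (not p ∨ q) → T p → T q
  implies {true} t _ = t

isMono⁺ : ∀ {n} (f : Fun n) → Monotone f → T (isMono f)
isMono⁺ f mono = T-allVecs⁺ _ λ u → T-allVecs⁺ _ λ v → implication (mono u v)
  where
  implication : ∀ {p q} → (T p → T q) → T (not p ∨ q)
  implication {true}  h = h tt
  implication {false} h = tt

cofactor₀ cofactor₁ : ∀ {n} → Fun (suc n) → Fun n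
cofactor₀ h z = h (false ∷ z)
cofactor₁ h z = h (true ∷ z)

leqF-cofactors : ∀ {n} (f g : Fun (suc n)) →
  leqF f g ≡ leqF (cofactor₀ f) (cofactor₀ g) ∧ leqF (cofactor₁ f) (cofactor₁ g)
leqF-cofactors f g = T-ext
  (λ f≤g → from T-∧ ( leqF⁺ (cofactor₀ f) (cofactor₀ g) (λ z → leqF⁻ f g f≤g (false ∷ z))
                    , leqF⁺ (cofactor₁ f) (cofactor₁ g) (λ z → leqF⁻ f g f≤g (true ∷ z))))
  (λ t → let (f₀≤g₀ , f₁≤g₁) = to T-∧ t in leqF⁺ f g λ
    { (false ∷ z) → leqF⁻ (cofactor₀ f) (cofactor₀ g) f₀≤g₀ z
    ; (true ∷ z)  → leqF⁻ (cofactor₁ f) (cofactor₁ g) f₁≤g₁ z })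

isMono-cofactors : ∀ {n} (h : Fun (suc n)) →
  isMono h ≡ isMono (cofactor₀ h) ∧ (isMono (cofactor₁ h) ∧ leqF (cofactor₀ h) (cofactor₁ h))
isMono-cofactors h = T-ext
  (λ t → let mono = isMono⁻ h t in from T-∧
    ( isMono⁺ (cofactor₀ h) (λ u v → mono (false ∷ u) (false ∷ v))
    , from T-∧ ( isMono⁺ (cofactor₁ h) (λ u v → mono (true ∷ u) (true ∷ v))
               , leqF⁺ (cofactor₀ h) (cofactor₁ h) (λ z → mono (false ∷ z) (true ∷ z) (leqV-refl z)))))
  (λ t → let (mono₀ , t′) = to T-∧ t
             (mono₁ , h₀≤h₁) = to T-∧ t′
         in isMono⁺ h λ
    { (false ∷ u) (false ∷ v) u≤v → isMono⁻ (cofactor₀ h) mono₀ u v u≤v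
    ; (true ∷ u)  (true ∷ v)  u≤v → isMono⁻ (cofactor₁ h) mono₁ u v u≤v
    ; (false ∷ u) (true ∷ v)  u≤v →
        ≤ᵇ-trans {h (false ∷ u)} (leqF⁻ (cofactor₀ h) (cofactor₁ h) h₀≤h₁ u)
                                 (isMono⁻ (cofactor₁ h) mono₁ u v u≤v)
    ; (true ∷ u)  (false ∷ v) () })

leqF-∪ : ∀ {n} (f g h : Fun n) → leqF (f ∪ g) h ≡ leqF f h ∧ leqF g h
leqF-∪ f g h = T-ext
  (λ t → from T-∧ ( leqF⁺ f h (λ z → ∨-≤ᵇ-left  (f z) (g z) (h z) (leqF⁻ (f ∪ g) h t z))
                  , leqF⁺ g h (λ z → ∨-≤ᵇ-right (f z) (g z) (h z) (leqF⁻ (f ∪ g) h t z))))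
  (λ t → let (f≤h , g≤h) = to T-∧ t in
    leqF⁺ (f ∪ g) h (λ z → ∨-≤ᵇ (f z) (g z) (h z) (leqF⁻ f h f≤h z) (leqF⁻ g h g≤h z)))
  where
  ∨-≤ᵇ-left : ∀ p q r → T ((p ∨ q) ≤ᵇ r) → T (p ≤ᵇ r)
  ∨-≤ᵇ-left false _ _ _ = tt
  ∨-≤ᵇ-left true  _ _ t = t
  ∨-≤ᵇ-right : ∀ p q r → T ((p ∨ q) ≤ᵇ r) → T (q ≤ᵇ r)
  ∨-≤ᵇ-right false _     _ t = t
  ∨-≤ᵇ-right true  false _ _ = tt
  ∨-≤ᵇ-right true  true  _ t = t
  ∨-≤ᵇ : ∀ p q r → T (p ≤ᵇ r) → T (q ≤ᵇ r) → T ((p ∨ q) ≤ᵇ r)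
  ∨-≤ᵇ false _ _ _   q≤r = q≤r
  ∨-≤ᵇ true  _ _ p≤r _   = p≤r

ind-isMono-cofactors : ∀ {n} (h : Fun (suc n)) →
  ind (isMono h) ≡ ind (isMono (cofactor₀ h)) * (ind (isMono (cofactor₁ h)) * ind (leqF (cofactor₀ h) (cofactor₁ h)))
ind-isMono-cofactors h =
  trans (cong ind (isMono-cofactors h))
        (trans (ind-∧ (isMono h₀) _) (cong (ind (isMono h₀) *_) (ind-∧ (isMono h₁) (leqF h₀ h₁))))
  where
  h₀ = cofactor₀ h
  h₁ = cofactor₁ h

ind-leqF-cofactors : ∀ {n} (f g : Fun (suc n)) →
  ind (leqF f g) ≡ ind (leqF (cofactor₀ f) (cofactor₀ g)) * ind (leqF (cofactor₁ f) (cofactor₁ g))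
ind-leqF-cofactors f g = trans (cong ind (leqF-cofactors f g)) (ind-∧ (leqF (cofactor₀ f) (cofactor₀ g)) _)

ind-leqF-∪-leqF : ∀ {n} (f g h k : Fun n) →
  ind (leqF (f ∪ g) h ∧ leqF h k) ≡ (ind (leqF f h) * ind (leqF g h)) * ind (leqF h k)
ind-leqF-∪-leqF f g h k =
  trans (ind-∧ (leqF (f ∪ g) h) _) (cong (_* ind (leqF h k)) (trans (cong ind (leqF-∪ f g h)) (ind-∧ (leqF f h) _)))

-- The cofactors of the pairing function used by allFuns (suc n) are definitionally its two halves.
∑-allFuns-suc : ∀ n (F : Fun n → Fun n → ℕ) →
  ∑[ h ∈ allFuns (suc n) ] F (cofactor₀ h) (cofactor₁ h) ≡ ∑[ f ∈ allFuns n ] ∑[ g ∈ allFuns n ] F f g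
∑-allFuns-suc n F = ∑-concatMap-map _ _ (allFuns n) (allFuns n)

∑-allFuns-2+ : ∀ n (F : Fun n → Fun n → Fun n → Fun n → ℕ) →
  ∑[ h ∈ allFuns (suc (suc n)) ] F (comp0 h) (comp1 h) (comp2 h) (comp3 h) ≡
  ∑[ a ∈ allFuns n ] ∑[ b ∈ allFuns n ] ∑[ c ∈ allFuns n ] ∑[ d ∈ allFuns n ] F a b c d
∑-allFuns-2+ n F =
  trans (∑-allFuns-suc (suc n) _)
        (trans (∑-cong (allFuns (suc n)) λ h₀ → ∑-allFuns-suc n (F (cofactor₀ h₀) (cofactor₁ h₀)))
               (∑-allFuns-suc n λ a b → ∑[ c ∈ allFuns n ] ∑[ d ∈ allFuns n ] F a b c d))

𝟙[_,⊤] : ∀ {n} → Fun n → Fun n → ℕ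
𝟙[ f ,⊤] h = ind (isMono h) * ind (leqF f h)

𝟙[_,_] : ∀ {n} → Fun n → Fun n → Fun n → ℕ
𝟙[ f , g ] h = ind (isMono h) * ind (leqF f h ∧ leqF h g)

#[,⊤]-as-∑ : ∀ {n} (f : Fun n) → #[ f ,⊤] ≡ ∑[ h ∈ allFuns n ] 𝟙[ f ,⊤] h
#[,⊤]-as-∑ {n} f = trans (length-filterᵇ (leqF f) (D n)) (∑-filterᵇ isMono _ (allFuns n))

#[,]-as-∑ : ∀ {n} (f g : Fun n) → #[ f , g ] ≡ ∑[ h ∈ allFuns n ] 𝟙[ f , g ] h
#[,]-as-∑ {n} f g = trans (length-filterᵇ _ (D n)) (∑-filterᵇ isMono _ (allFuns n))

∑-up : ∀ {n} (f : Fun n) (F : Fun n → ℕ) → ∑ (up f) F ≡ ∑[ h ∈ allFuns n ] 𝟙[ f ,⊤] h * F h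
∑-up {n} f F =
  trans (∑-filterᵇ (leqF f) F (D n))
        (trans (∑-filterᵇ isMono _ (allFuns n))
               (∑-cong (allFuns n) λ h → sym (*-assoc (ind (isMono h)) _ _)))

module _ {n} (x : Fun (suc (suc n))) where

  inner-weight weight : Fun n → Fun n → Fun n → Fun n → ℕ
  inner-weight a b c d = 𝟙[ comp3 x ,⊤] d * (𝟙[ a ∪ comp1 x , d ] b * 𝟙[ a ∪ comp2 x , d ] c)
  weight a b c d = 𝟙[ comp0 x ,⊤] a * inner-weight a b c d

  𝟙[,⊤]-decomposition : ∀ h → 𝟙[ x ,⊤] h ≡ weight (comp0 h) (comp1 h) (comp2 h) (comp3 h)
  𝟙[,⊤]-decomposition h = begin
    ind (isMono h) * ind (leqF x h)
      ≡⟨ cong₂ _*_ isMono-h leqF-x-h ⟩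
    (ma * (mb * ab)) * ((mc * (md * cd)) * (ac * bd)) * ((xa * xb) * (xc * xd))
      ≡⟨ rearrange ma mb mc md ab cd ac bd xa xb xc xd ⟩
    (ma * xa) * ((md * xd) * ((mb * ((ab * xb) * bd)) * (mc * ((ac * xc) * cd))))
      ≡⟨ cong₂ (λ p q → (ma * xa) * ((md * xd) * ((mb * p) * (mc * q))))
               (sym (ind-leqF-∪-leqF a (comp1 x) b d)) (sym (ind-leqF-∪-leqF a (comp2 x) c d)) ⟩
    weight a b c d ∎
    where
    open ≡-Reasoning
    a = comp0 h
    b = comp1 h
    c = comp2 h
    d = comp3 h
    ma = ind (isMono a)
    mb = ind (isMono b)
    mc = ind (isMono c)
    md = ind (isMono d)
    ab = ind (leqF a b)
    cd = ind (leqF c d)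
    ac = ind (leqF a c)
    bd = ind (leqF b d)
    xa = ind (leqF (comp0 x) a)
    xb = ind (leqF (comp1 x) b)
    xc = ind (leqF (comp2 x) c)
    xd = ind (leqF (comp3 x) d)
    isMono-h : ind (isMono h) ≡ (ma * (mb * ab)) * ((mc * (md * cd)) * (ac * bd))
    isMono-h = trans (ind-isMono-cofactors h)
      (cong₂ _*_ (ind-isMono-cofactors (cofactor₀ h))
                 (cong₂ _*_ (ind-isMono-cofactors (cofactor₁ h)) (ind-leqF-cofactors (cofactor₀ h) (cofactor₁ h))))
    leqF-x-h : ind (leqF x h) ≡ (xa * xb) * (xc * xd)
    leqF-x-h = trans (ind-leqF-cofactors x h)
      (cong₂ _*_ (ind-leqF-cofactors (cofactor₀ x) (cofactor₀ h)) (ind-leqF-cofactors (cofactor₁ x) (cofactor₁ h)))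
    rearrange : ∀ ma mb mc md ab cd ac bd xa xb xc xd →
      (ma * (mb * ab)) * ((mc * (md * cd)) * (ac * bd)) * ((xa * xb) * (xc * xd)) ≡
      (ma * xa) * ((md * xd) * ((mb * ((ab * xb) * bd)) * (mc * ((ac * xc) * cd))))
    rearrange = solve-∀

  #[,⊤]-as-∑-weight : #[ x ,⊤] ≡
    ∑[ a ∈ allFuns n ] ∑[ b ∈ allFuns n ] ∑[ c ∈ allFuns n ] ∑[ d ∈ allFuns n ] weight a b c d
  #[,⊤]-as-∑-weight = begin
    #[ x ,⊤]
      ≡⟨ #[,⊤]-as-∑ x ⟩
    ∑[ h ∈ allFuns (suc (suc n)) ] 𝟙[ x ,⊤] h
      ≡⟨ ∑-cong (allFuns (suc (suc n))) 𝟙[,⊤]-decomposition ⟩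
    ∑[ h ∈ allFuns (suc (suc n)) ] weight (comp0 h) (comp1 h) (comp2 h) (comp3 h)
      ≡⟨ ∑-allFuns-2+ n weight ⟩
    ∑[ a ∈ allFuns n ] ∑[ b ∈ allFuns n ] ∑[ c ∈ allFuns n ] ∑[ d ∈ allFuns n ] weight a b c d ∎
    where open ≡-Reasoning

  ∑-corners-as-∑-weight :
    ∑[ a ∈ up (comp0 x) ] ∑[ d ∈ up (comp3 x) ] #[ a ∪ comp1 x , d ] * #[ a ∪ comp2 x , d ] ≡
    ∑[ a ∈ allFuns n ] ∑[ b ∈ allFuns n ] ∑[ c ∈ allFuns n ] ∑[ d ∈ allFuns n ] weight a b c d
  ∑-corners-as-∑-weight = begin
    ∑[ a ∈ up (comp0 x) ] ∑[ d ∈ up (comp3 x) ] #[ a ∪ comp1 x , d ] * #[ a ∪ comp2 x , d ]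
      ≡⟨ ∑-up (comp0 x) _ ⟩
    ∑[ a ∈ Fs ] 𝟙[ comp0 x ,⊤] a * (∑[ d ∈ up (comp3 x) ] #[ a ∪ comp1 x , d ] * #[ a ∪ comp2 x , d ])
      ≡⟨ ∑-cong Fs (λ a → cong (𝟙[ comp0 x ,⊤] a *_) (inner a)) ⟩
    ∑[ a ∈ Fs ] 𝟙[ comp0 x ,⊤] a * (∑[ b ∈ Fs ] ∑[ c ∈ Fs ] ∑[ d ∈ Fs ] inner-weight a b c d)
      ≡⟨ ∑-cong Fs (λ a → *-distribˡ-∑³ (𝟙[ comp0 x ,⊤] a) (inner-weight a)) ⟩
    ∑[ a ∈ Fs ] ∑[ b ∈ Fs ] ∑[ c ∈ Fs ] ∑[ d ∈ Fs ] weight a b c d ∎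
    where
    open ≡-Reasoning
    Fs = allFuns n

    *-distribˡ-∑² : ∀ k (F : Fun n → Fun n → ℕ) →
      k * (∑[ b ∈ Fs ] ∑[ c ∈ Fs ] F b c) ≡ ∑[ b ∈ Fs ] ∑[ c ∈ Fs ] k * F b c
    *-distribˡ-∑² k F = trans (*-distribˡ-∑ k _ Fs) (∑-cong Fs λ b → *-distribˡ-∑ k (F b) Fs)

    *-distribˡ-∑³ : ∀ k (F : Fun n → Fun n → Fun n → ℕ) →
      k * (∑[ b ∈ Fs ] ∑[ c ∈ Fs ] ∑[ d ∈ Fs ] F b c d) ≡ ∑[ b ∈ Fs ] ∑[ c ∈ Fs ] ∑[ d ∈ Fs ] k * F b c d
    *-distribˡ-∑³ k F = trans (*-distribˡ-∑ k _ Fs) (∑-cong Fs λ b → *-distribˡ-∑² k (F b))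

    inner : ∀ a → ∑[ d ∈ up (comp3 x) ] #[ a ∪ comp1 x , d ] * #[ a ∪ comp2 x , d ] ≡
                  ∑[ b ∈ Fs ] ∑[ c ∈ Fs ] ∑[ d ∈ Fs ] inner-weight a b c d
    inner a = begin
      ∑[ d ∈ up (comp3 x) ] #[ u , d ] * #[ v , d ]
        ≡⟨ ∑-up (comp3 x) _ ⟩
      ∑[ d ∈ Fs ] 𝟙[ comp3 x ,⊤] d * (#[ u , d ] * #[ v , d ])
        ≡⟨ ∑-cong Fs (λ d → cong (𝟙[ comp3 x ,⊤] d *_) (trans (cong₂ _*_ (#[,]-as-∑ u d) (#[,]-as-∑ v d))
                                                             (∑-*-∑ 𝟙[ u , d ] 𝟙[ v , d ] Fs Fs))) ⟩
      ∑[ d ∈ Fs ] 𝟙[ comp3 x ,⊤] d * (∑[ b ∈ Fs ] ∑[ c ∈ Fs ] 𝟙[ u , d ] b * 𝟙[ v , d ] c)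
        ≡⟨ ∑-cong Fs (λ d → *-distribˡ-∑² (𝟙[ comp3 x ,⊤] d) λ b c → 𝟙[ u , d ] b * 𝟙[ v , d ] c) ⟩
      ∑[ d ∈ Fs ] ∑[ b ∈ Fs ] ∑[ c ∈ Fs ] inner-weight a b c d
        ≡⟨ ∑-comm (λ d b → ∑[ c ∈ Fs ] inner-weight a b c d) Fs Fs ⟩
      ∑[ b ∈ Fs ] ∑[ d ∈ Fs ] ∑[ c ∈ Fs ] inner-weight a b c d
        ≡⟨ ∑-cong Fs (λ b → ∑-comm (λ d c → inner-weight a b c d) Fs Fs) ⟩
      ∑[ b ∈ Fs ] ∑[ c ∈ Fs ] ∑[ d ∈ Fs ] inner-weight a b c d ∎
      where
      u = a ∪ comp1 x
      v = a ∪ comp2 x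

mainTheorem1 : (n : ℕ) (x : Fun (suc (suc n))) → T (isMono x) →
    #[ x ,⊤] ≡
      sum (map (λ y₀ → sum (map (λ y₃ →
             #[ y₀ ∪ comp1 x , y₃ ] * #[ y₀ ∪ comp2 x , y₃ ])
           (up (comp3 x))))
        (up (comp0 x)))
mainTheorem1 n x _ = trans (#[,⊤]-as-∑-weight x) (sym (∑-corners-as-∑-weight x))
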